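{- Let $L$ be a nonempty set, let $\mathcal C$ be the set of all consequence operators on $L$, ordered by $C_1\le C_2$ iff $C_1(X)\subseteq C_2(X)$ for all $X\subseteq L$, and let $I$ be the identity map on $\mathcal P(L)$. For $x\in L$ let $E_x=C'(\{x\},L\setminus\{x\})$, i.e. $E_x(A)=A\cup\{x\}$ if $L\setminus\{x\}\subseteq A$ and $E_x(A)=A$ otherwise, and let $\mathcal E_0=\{E_x : x\in L\}$. Then: (a) each $E_x$ is an atom of $\langle\mathcal C,\le\rangle$, i.e. $I< E_x$ and there is no $C\in\mathcal C$ with $I<C<E_x$; and (b) the set $\mathcal C_A$ of all axiomatic consequence operators on $L$ densely covers $\mathcal E_0$, i.e. for every $C\in\mathcal C$ with $C(\emptyset)\neq\emptyset$ there exists $x\in L$ with $E_x\le C$.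
   Context: A consequence operator on a nonempty set $L$ is a map $C\colon\mathcal P(L)\to\mathcal P(L)$ such that for all $X,Y\subseteq L$: $X\subseteq C(X)=C(C(X))\subseteq L$, and $X\subseteq Y$ implies $C(X)\subseteq C(Y)$. $C$ is axiomatic if $C(\emptyset)\ne\emptyset$. $C_1<C_2$ means $C_1\le C_2$ and $C_1\neq C_2$. -}

module Defs where

open import Level using (0ℓ)
open import Data.Product using (Σ; _×_; _,_)
open import Data.Sum using (_⊎_)
open import Data.Empty using (⊥)
open import Relation.Nullary using (¬_)
open import Relation.Binary.PropositionalEquality using (_≡_; _≢_)
open import Relation.Unary using (Pred; _⊆_; _∈_; ∅)

Subset : Set → Set₁
Subset L = Pred L 0ℓ

Op : Set → Set₁
Op L = Subset L → Subset L

_≐_ : {L : Set} → Subset L → Subset L → Set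
X ≐ Y = (X ⊆ Y) × (Y ⊆ X)

record IsConsequence {L : Set} (C : Op L) : Set₁ where
  field
    extensive  : ∀ (X : Subset L) → X ⊆ C X
    idempotent : ∀ (X : Subset L) → C (C X) ≐ C X
    monotone   : ∀ (X Y : Subset L) → X ⊆ Y → C X ⊆ C Y

IsAxiomatic : {L : Set} → Op L → Set
IsAxiomatic {L} C = ¬ (C ∅ ≐ ∅)

_≤C_ : {L : Set} → Op L → Op L → Set₁
C₁ ≤C C₂ = ∀ X → C₁ X ⊆ C₂ X

_≈C_ : {L : Set} → Op L → Op L → Set₁
C₁ ≈C C₂ = ∀ X → C₁ X ≐ C₂ X

_<C_ : {L : Set} → Op L → Op L → Set₁
C₁ <C C₂ = (C₁ ≤C C₂) × ¬ (C₁ ≈C C₂)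

I : {L : Set} → Op L
I X = X

-- E_x(A) = A ∪ {x} if L∖{x} ⊆ A, and A otherwise; i.e.
-- y ∈ E_x(A)  iff  y ∈ A, or (y = x and L∖{x} ⊆ A).
E : {L : Set} → L → Op L
E x A y = A y ⊎ ((y ≡ x) × (∀ z → z ≢ x → A z))

IsAtom : {L : Set} → Op L → Set₁
IsAtom {L} C = IsConsequence C × (I <C C) ×
  ((D : Op L) → IsConsequence D → ¬ ((I <C D) × (D <C C)))

-- E_x only ever adds the single point x, and only to sets containing L ∖ {x}.
-- Hence a consequence operator D produces E_x as soon as it derives x from
-- some X ∌ x: such an X lies inside every A ⊇ L ∖ {x}, so x ∈ D X ⊆ D A.
-- Classically, below E_x this leaves D two options: it derives no new element, so D = I,
-- or it derives x from such an X, so D = E_x. For axiomatic C, any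
-- x ∈ C ∅ is derived from ∅ ∌ x, so E_x ≤ C.
module Submission where

open import Defs
open import Data.Product using (Σ; _×_; _,_; proj₂)
open import Data.Sum using (inj₁; inj₂)
open import Data.Empty using (⊥; ⊥-elim)
open import Axiom.ExcludedMiddle using (ExcludedMiddle)
open import Level using (0ℓ)
open import Relation.Nullary using (yes; no; ¬_; contradiction)
open import Relation.Binary.PropositionalEquality using (_≡_; refl; subst)
open import Relation.Unary using (_⊆_)

module _ {L : Set} where

  E-isConsequence : (x : L) → IsConsequence (E x)
  E-isConsequence x = record
    { extensive  = λ X → inj₁
    ; idempotent = λ X → E-idempotent X , inj₁
    ; monotone   = E-monotone
    }
    where
    E-monotone : ∀ X Y → X ⊆ Y → E x X ⊆ E x Y
    E-monotone X Y X⊆Y (inj₁ y∈X)        = inj₁ (X⊆Y y∈X)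
    E-monotone X Y X⊆Y (inj₂ (y≡x , co)) = inj₂ (y≡x , λ z z≢x → X⊆Y (co z z≢x))

    E-idempotent : ∀ X → E x (E x X) ⊆ E x X
    E-idempotent X (inj₁ y∈ExX)       = y∈ExX
    E-idempotent X (inj₂ (y≡x , co)) = inj₂ (y≡x , λ z z≢x → off-x z z≢x (co z z≢x))
      where
      off-x : ∀ z → ¬ z ≡ x → E x X z → X z
      off-x z z≢x (inj₁ z∈X)       = z∈X
      off-x z z≢x (inj₂ (z≡x , _)) = contradiction z≡x z≢x

  I<E : (x : L) → I <C E x
  I<E x = (λ X → inj₁) , I≉E
    where
    co-x : Subset L
    co-x z = ¬ z ≡ x

    I≉E : ¬ (I ≈C E x)
    I≉E I≈E = proj₂ (I≈E co-x) (inj₂ (refl , λ z z≢x → z≢x)) refl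

  ≤-antisym : {C₁ C₂ : Op L} → C₁ ≤C C₂ → C₂ ≤C C₁ → C₁ ≈C C₂
  ≤-antisym C₁≤C₂ C₂≤C₁ X = C₁≤C₂ X , C₂≤C₁ X

  newConsequence⇒E≤ : {D : Op L} → IsConsequence D →
                      {X : Subset L} {x : L} → ¬ X x → D X x → E x ≤C D
  newConsequence⇒E≤ DC x∉X x∈DX A (inj₁ y∈A)       = IsConsequence.extensive DC A y∈A
  newConsequence⇒E≤ DC {X} x∉X x∈DX A (inj₂ (refl , co)) =
    IsConsequence.monotone DC X A (λ {z} z∈X → co z (λ z≡x → x∉X (subst X z≡x z∈X))) x∈DX

  module _ (lem : ExcludedMiddle 0ℓ) where

    ≤E⇒≤I : {D : Op L} {x : L} → IsConsequence D →
            D ≤C E x → ¬ (E x ≤C D) → D ≤C I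
    ≤E⇒≤I DC D≤E E≰D X {w} w∈DX with lem {X w}
    ... | yes w∈X = w∈X
    ... | no  w∉X with D≤E X w∈DX
    ...   | inj₁ w∈X        = contradiction w∈X w∉X
    ...   | inj₂ (refl , _) = contradiction (newConsequence⇒E≤ DC w∉X w∈DX) E≰D

    E-isAtom : (x : L) → IsAtom (E x)
    E-isAtom x = E-isConsequence x , I<E x , noneBetween
      where
      noneBetween : (D : Op L) → IsConsequence D → ¬ ((I <C D) × (D <C E x))
      noneBetween D DC ((_ , I≉D) , (D≤E , D≉E)) = I≉D (≤-antisym (IsConsequence.extensive DC) D≤I)
        where
        D≤I : D ≤C I
        D≤I = ≤E⇒≤I DC D≤E (λ E≤D → D≉E (≤-antisym D≤E E≤D))

    axiomatic⇒E≤ : (C : Op L) → IsConsequence C → IsAxiomatic C → Σ L (λ x → E x ≤C C)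
    axiomatic⇒E≤ C CC ax with lem {Σ L (C (λ _ → ⊥))}
    ... | yes (x , x∈C∅) = x , newConsequence⇒E≤ CC (λ ()) x∈C∅
    ... | no  C∅-empty   = ⊥-elim (ax ((λ {y} y∈C∅ → C∅-empty (y , y∈C∅)) , λ ()))

theorem2p7 : ExcludedMiddle 0ℓ → (L : Set) → L →
    ((x : L) → IsAtom (E x)) ×
    ((C : Op L) → IsConsequence C → IsAxiomatic C → Σ L (λ x → E x ≤C C))
theorem2p7 lem L _ = E-isAtom lem , axiomatic⇒E≤ lem
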